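{- Fix a location $l$ of a Linear Hybrid Automaton and a polyhedron $E$. Let $\pi=G_0\rightsquigarrow_{P_1,R_1}G_1\rightsquigarrow_{P_2,R_2}\cdots\rightsquigarrow_{P_m,R_m}G_m$ be a sequence of refinement steps and let $R$ be an entry region of $G_m$. Then $R$ is an entry region of $\tau^m(G_0,\overline E,G_0)$.
   Context: Convex polyhedra are finite intersections of strict or non-strict affine half-spaces of $\mathbb{R}^n$; polyhedra are finite unions of them, each polyhedron $G$ given by a representation $[\![G]\!]$, a finite set of convex polyhedra with union $G$; $\overline G$ is the complement in $\mathbb{R}^n$ (with $[\![\overline{\overline E}]\!]=[\![E]\!]$). $\mathrm{cl}(G)$ is the closure, $\mathrm{bound}(G,G')=(\mathrm{cl}(G)\cap G')\cup(G\cap\mathrm{cl}(G'))$. The LHA assigns to location $l$ a convex polyhedron $\mathrm{Flow}(l)$ of allowed derivatives, and $\mathrm{Pre}^{\mathrm{flow}}_l(G)=\{u\mid\exists\delta\ge0,\ c\in\mathrm{Flow}(l): u+\delta c\in G\}$. Entry regions (relative to $E$): for $P\in[\![E]\!]$, $P'\in[\![G]\!]$, the entry region from $P$ to $P'$ is $R=\mathrm{bound}(P,P')\cap\mathrm{Pre}^{\mathrm{flow}}_l(P')$; a (nonempty) such set is an entry region of $G$. If it is nonempty, the refinement step $G\rightsquigarrow_{P,R}G'$ yields $G'$ with $[\![G']\!]=[\![G]\!]\cup\{P\cap\mathrm{Pre}^{\mathrm{flow}}_l(R)\}$. Operator: $\tau(U,V,W)=U\cup\bigcup_{P\in[\![\overline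 V]\!]}\bigcup_{P'\in[\![W]\!]}\big(P\cap\mathrm{Pre}^{\mathrm{flow}}_l(\mathrm{bound}(P,P')\cap\mathrm{Pre}^{\mathrm{flow}}_l(P'))\big)$, whose representation consists of $[\![U]\!]$ together with the added sets. Iterates: $\tau^0(U,V,U)=U$ and $\tau^{i+1}(U,V,U)=\tau(U,V,\tau^i(U,V,U))$. -}

module Defs where

open import Level using (0ℓ)
open import Data.Nat using (ℕ; zero; suc)
open import Data.Fin using (Fin) renaming (zero to fzero; suc to fsuc)
open import Data.Unit using (⊤)
open import Data.List using (List; []; _∷_; _++_; [_]; concatMap)
open import Data.List.Membership.Propositional using (_∈_)
open import Data.List.Relation.Unary.All using (All)
open import Data.Product using (Σ; ∃; _×_; _,_)
open import Data.Sum using (_⊎_; inj₁; inj₂)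
open import Relation.Binary.PropositionalEquality using (_≡_)
open import Relation.Nullary using (¬_)
open import Algebra.Bundles using (CommutativeRing)

-- The scalar field.  The paper works over ℝ; agda-stdlib has no reals,
-- so everything is stated for an arbitrary ordered field (ℝ is one).

record OrderedField : Set₁ where
  field
    commRing : CommutativeRing 0ℓ 0ℓ
  open CommutativeRing commRing public
  field
    _<_      : Carrier → Carrier → Set
    0≉1      : ¬ (0# ≈ 1#)
    inverse  : ∀ x → ¬ (x ≈ 0#) → Σ Carrier λ y → x * y ≈ 1#
    <-irrefl : ∀ {x} → ¬ (x < x)
    <-trans  : ∀ {x y z} → x < y → y < z → x < z
    <-tri    : ∀ x y → x < y ⊎ (x ≈ y ⊎ y < x)
    +-mono-< : ∀ {x y} z → x < y → (x + z) < (y + z)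
    *-pos    : ∀ {x y} → 0# < x → 0# < y → 0# < (x * y)

  _≤_ : Carrier → Carrier → Set
  x ≤ y = x < y ⊎ x ≈ y

module Polyhedra (F : OrderedField) (n : ℕ) where
  open OrderedField F using (Carrier; _≈_; _+_; _*_; -_; _-_; 0#; _<_; _≤_; <-tri)

  Point : Set
  Point = Fin n → Carrier

  Region : Set₁
  Region = Point → Set

  _∩_ : Region → Region → Region
  (A ∩ B) x = A x × B x

  _⊆_ : Region → Region → Set
  A ⊆ B = ∀ x → A x → B x

  _≐_ : Region → Region → Set
  A ≐ B = A ⊆ B × B ⊆ A

  Nonempty : Region → Set
  Nonempty A = ∃ λ x → A x

  dot : Point → Point → Carrier
  dot a x = go n a x
    where
    go : (k : ℕ) → (Fin k → Carrier) → (Fin k → Carrier) → Carrier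
    go zero    a x = 0#
    go (suc k) a x = (a fzero * x fzero) + go k (λ i → a (fsuc i)) (λ i → x (fsuc i))

  _⊕_ : Point → Point → Point
  (u ⊕ v) i = u i + v i

  _⊛_ : Carrier → Point → Point
  (d ⊛ v) i = d * v i

  data HalfSpace : Set where
    strict    : Point → Carrier → HalfSpace
    nonstrict : Point → Carrier → HalfSpace

  ⟦_⟧ₕ : HalfSpace → Region
  ⟦ strict a b ⟧ₕ x    = dot a x < b
  ⟦ nonstrict a b ⟧ₕ x = dot a x ≤ b

  ⟦_⟧ᶜ : List HalfSpace → Region
  ⟦ [] ⟧ᶜ x     = ⊤
  ⟦ h ∷ hs ⟧ᶜ x = ⟦ h ⟧ₕ x × ⟦ hs ⟧ᶜ x

  IsConvexPolyhedron : Region → Set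
  IsConvexPolyhedron A = Σ (List HalfSpace) λ hs → A ≐ ⟦ hs ⟧ᶜ

  -- a representation [[G]] of a polyhedron G: a finite set (list) of
  -- convex polyhedra; G itself is their union.
  Rep : Set₁
  Rep = List Region

  IsRep : Rep → Set₁
  IsRep = All IsConvexPolyhedron

  ∣_∣ : Carrier → Carrier
  ∣ x ∣ with <-tri x 0#
  ... | inj₁ _ = - x
  ... | inj₂ _ = x

  cl : Region → Region
  cl A x = ∀ ε → 0# < ε → Σ Point λ y → A y × (∀ i → ∣ x i - y i ∣ < ε)

  bound : Region → Region → Region
  bound A B x = (cl A x × B x) ⊎ (A x × cl B x)

  Preflow : Region → Region → Region
  Preflow Flow G u = Σ Carrier λ δ → Σ Point λ c →
                     (0# ≤ δ) × Flow c × G (u ⊕ (δ ⊛ c))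

  module Location (Flow : Region) where

    entry : Region → Region → Region
    entry P P' = bound P P' ∩ Preflow Flow P'

    IsEntryRegion : (E : Rep) → (G : Rep) → Region → Set₁
    IsEntryRegion E G R =
      Σ Region λ P → Σ Region λ P' →
        (P ∈ E) × (P' ∈ G) × (R ≐ entry P P') × Nonempty R

    data Step (E : Rep) (G : Rep) (P R : Region) : Rep → Set₁ where
      step : (P' : Region) → P ∈ E → P' ∈ G → R ≐ entry P P' → Nonempty R →
             Step E G P R (G ++ [ P ∩ Preflow Flow R ])

    data Steps (E : Rep) : ℕ → Rep → Rep → Set₁ where
      done : ∀ {G} → Steps E zero G G
      next : ∀ {m G₀ G G'} (P R : Region) →
             Steps E m G₀ G → Step E G P R G' → Steps E (suc m) G₀ G'

    -- τ(U, V, W); the argument Vbar is the representation [[V̄]]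
    τ : Rep → Rep → Rep → Rep
    τ U Vbar W = U ++ concatMap (λ P → concatMap (λ P' →
                   [ P ∩ Preflow Flow (entry P P') ]) W) Vbar

    τ^ : ℕ → Rep → Rep → Rep
    τ^ zero    U Vbar = U
    τ^ (suc i) U Vbar = τ U Vbar (τ^ i U Vbar)

module Submission where

-- The proof compares representations up to extensional equality of their
-- members: G ≼ H says that every convex piece of G coincides (as a set)
-- with some piece of H.  Entry regions only depend on the pieces of a
-- representation as sets, so they transfer along ≼.

open import Defs
open import Data.Nat using (ℕ; zero; suc)
open import Data.List using (_++_; [_])
open import Data.List.Membership.Propositional using (_∈_; find; lose)
open import Data.List.Membership.Propositional.Properties
  using (∈-++⁺ˡ; ∈-++⁺ʳ; ∈-++⁻; ∈-concatMap⁺; ∈-concatMap⁻)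
open import Data.List.Relation.Unary.Any using (here)
open import Data.Product using (Σ; _×_; _,_)
open import Data.Sum using (inj₁; inj₂)
open import Relation.Binary.PropositionalEquality using (refl)

module SetFacts (F : OrderedField) (n : ℕ) where
  open Polyhedra F n

  ≐-refl : ∀ {A} → A ≐ A
  ≐-refl = (λ _ a → a) , (λ _ a → a)

  ≐-trans : ∀ {A B C} → A ≐ B → B ≐ C → A ≐ C
  ≐-trans (A⊆B , B⊆A) (B⊆C , C⊆B) =
    (λ x a → B⊆C x (A⊆B x a)) , (λ x c → B⊆A x (C⊆B x c))

  cl-mono : ∀ {A B} → A ⊆ B → cl A ⊆ cl B
  cl-mono A⊆B x x∈clA ε ε>0 with x∈clA ε ε>0
  ... | y , y∈A , close = y , A⊆B y y∈A , close

  Preflow-mono : ∀ Flow {A B} → A ⊆ B → Preflow Flow A ⊆ Preflow Flow B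
  Preflow-mono Flow A⊆B u (δ , c , δ≥0 , c∈Flow , reached) =
    δ , c , δ≥0 , c∈Flow , A⊆B _ reached

  Preflow-resp : ∀ Flow {A B} → A ≐ B → Preflow Flow A ≐ Preflow Flow B
  Preflow-resp Flow (A⊆B , B⊆A) = Preflow-mono Flow A⊆B , Preflow-mono Flow B⊆A

module Refinement (F : OrderedField) (n : ℕ) (Flow : Polyhedra.Region F n) where
  open Polyhedra F n
  open Location Flow
  open SetFacts F n

  entry-mono : ∀ P {A B} → A ⊆ B → entry P A ⊆ entry P B
  entry-mono P A⊆B x (inj₁ (x∈clP , x∈A) , pre) =
    inj₁ (x∈clP , A⊆B x x∈A) , Preflow-mono Flow A⊆B x pre
  entry-mono P A⊆B x (inj₂ (x∈P , x∈clA) , pre) =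
    inj₂ (x∈P , cl-mono A⊆B x x∈clA) , Preflow-mono Flow A⊆B x pre

  entry-resp : ∀ P {A B} → A ≐ B → entry P A ≐ entry P B
  entry-resp P (A⊆B , B⊆A) = entry-mono P A⊆B , entry-mono P B⊆A

  refine-resp : ∀ P {A B} → A ≐ B → (P ∩ Preflow Flow A) ≐ (P ∩ Preflow Flow B)
  refine-resp P A≐B with Preflow-resp Flow A≐B
  ... | A⊆B , B⊆A =
    (λ x (x∈P , pre) → x∈P , A⊆B x pre) , (λ x (x∈P , pre) → x∈P , B⊆A x pre)

  _≼_ : Rep → Rep → Set₁
  G ≼ H = ∀ {Q} → Q ∈ G → Σ Region λ Q' → Q' ∈ H × Q ≐ Q'

  ≼-refl : ∀ {G} → G ≼ G
  ≼-refl {Q = Q} Q∈G = Q , Q∈G , ≐-refl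

  ≼-trans : ∀ {G H K} → G ≼ H → H ≼ K → G ≼ K
  ≼-trans G≼H H≼K Q∈G with G≼H Q∈G
  ... | Q' , Q'∈H , Q≐Q' with H≼K Q'∈H
  ... | Q'' , Q''∈K , Q'≐Q'' = Q'' , Q''∈K , ≐-trans Q≐Q' Q'≐Q''

  ≼-++ˡ : ∀ {G H} → G ≼ (G ++ H)
  ≼-++ˡ {Q = Q} Q∈G = Q , ∈-++⁺ˡ Q∈G , ≐-refl

  ≼-snoc : ∀ {G H Q} → G ≼ H → (Σ Region λ Q' → Q' ∈ H × Q ≐ Q') → (G ++ [ Q ]) ≼ H
  ≼-snoc {G} G≼H matched Q∈G++Q with ∈-++⁻ G Q∈G++Q
  ... | inj₁ Q∈G        = G≼H Q∈G
  ... | inj₂ (here refl) = matched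

  entryRegion-≼ : ∀ {E G H R} → G ≼ H → IsEntryRegion E G R → IsEntryRegion E H R
  entryRegion-≼ G≼H (P , P' , P∈E , P'∈G , R≐entry , nonempty) with G≼H P'∈G
  ... | P'' , P''∈H , P'≐P'' =
    P , P'' , P∈E , P''∈H , ≐-trans R≐entry (entry-resp P P'≐P'') , nonempty

  refinePiece : Region → Region → Region
  refinePiece P P' = P ∩ Preflow Flow (entry P P')

  refinePiece-∈-τ : ∀ U {V W P P'} → P ∈ V → P' ∈ W → refinePiece P P' ∈ τ U V W
  refinePiece-∈-τ U P∈V P'∈W =
    ∈-++⁺ʳ U (∈-concatMap⁺ _ (lose P∈V (∈-concatMap⁺ _ (lose P'∈W (here refl)))))

  τ-≼-mono : ∀ U V {W W'} → W ≼ W' → τ U V W ≼ τ U V W'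
  τ-≼-mono U V {W} W≼W' Q∈τ with ∈-++⁻ U Q∈τ
  ... | inj₁ Q∈U = _ , ∈-++⁺ˡ Q∈U , ≐-refl
  ... | inj₂ Q∈added with find (∈-concatMap⁻ _ {xs = V} Q∈added)
  ... | P , P∈V , Q∈fromP with find (∈-concatMap⁻ _ {xs = W} Q∈fromP)
  ... | P' , P'∈W , here refl with W≼W' P'∈W
  ... | P'' , P''∈W' , P'≐P'' =
    refinePiece P P'' , refinePiece-∈-τ U P∈V P''∈W' ,
    refine-resp P (entry-resp P P'≐P'')

  τ^-≼-suc : ∀ U V i → τ^ i U V ≼ τ^ (suc i) U V
  τ^-≼-suc U V zero    = ≼-++ˡ
  τ^-≼-suc U V (suc i) = τ-≼-mono U V (τ^-≼-suc U V i)

  stepPiece-in-τ : ∀ {E G G' P R} U {W} → Step E G P R G' → G ≼ W →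
                   Σ Region λ Q → Q ∈ τ U E W × (P ∩ Preflow Flow R) ≐ Q
  stepPiece-in-τ {P = P} U (step P' P∈E P'∈G R≐entry _) G≼W with G≼W P'∈G
  ... | P'' , P''∈W , P'≐P'' =
    refinePiece P P'' , refinePiece-∈-τ U P∈E P''∈W ,
    refine-resp P (≐-trans R≐entry (entry-resp P P'≐P''))

  steps-≼-τ^ : ∀ {E m G₀ G} → Steps E m G₀ G → G ≼ τ^ m G₀ E
  steps-≼-τ^ done = ≼-refl
  -- (matching on the step exposes Gₘ = Gₘ₋₁ ++ [ P ∩ Pre(R) ])
  steps-≼-τ^ {E} {suc m} {G₀} (next P R steps st@(step _ _ _ _ _)) =
    ≼-snoc (≼-trans G≼τ^m (τ^-≼-suc G₀ E m)) (stepPiece-in-τ G₀ st G≼τ^m)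
    where
    G≼τ^m = steps-≼-τ^ steps

lemma7 : (F : OrderedField) (n : ℕ) →
    let open Polyhedra F n in
    (Flow : Region) → IsConvexPolyhedron Flow →
    let open Location Flow in
    (E : Rep) → IsRep E →
    (m : ℕ) (G₀ Gₘ : Rep) → IsRep G₀ →
    Steps E m G₀ Gₘ →
    (R : Region) → IsEntryRegion E Gₘ R →
    IsEntryRegion E (τ^ m G₀ E) R
lemma7 F n Flow _ E _ m G₀ Gₘ _ steps R isEntry =
  entryRegion-≼ (steps-≼-τ^ steps) isEntry
  where open Refinement F n Flow
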